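{- Let there be a tight derivation in system $\mathcal{V}$ of $\Gamma\vdash^{(m,e,s)} t:\sigma$. Then $m=e=0$ if and only if $t\in\mathsf{no}_v$.
   Context: Terms are $t,u,r ::= x \mid \lambda x.t \mid t\,u \mid t[x\backslash u]$ over a countably infinite set of variables, where $t[x\backslash u]$ (explicit substitution) binds $x$ in $t$; terms are taken modulo $\alpha$-conversion. CBV normal forms: $\mathsf{vr}_v ::= x \mid \mathsf{vr}_v[x\backslash \mathsf{ne}_v]$; $\mathsf{ne}_v ::= \mathsf{vr}_v\,\mathsf{no}_v \mid \mathsf{ne}_v\,\mathsf{no}_v \mid \mathsf{ne}_v[x\backslash\mathsf{ne}_v]$; $\mathsf{no}_v ::= \lambda x.t \mid \mathsf{vr}_v \mid \mathsf{ne}_v \mid \mathsf{no}_v[x\backslash\mathsf{ne}_v]$. Types. Tight types: $\mathtt{tt} ::= \mathtt{n} \mid \mathtt{vl} \mid \mathtt{vr}$. Types $\sigma,\tau ::= \mathtt{tt}\mid\mathcal{M}\mid\mathcal{M}\to\sigma$, with multitypes $\mathcal{M}=[\sigma_i]_{i\in I}$ finite multisets of types ($[\,]$ empty, $\sqcup$ union). Typing contexts $\Gamma$ map variables to multitypes, $[\,]$ for all but finitely many; $(\Gamma+\Delta)(x)=\Gamma(x)\sqcup\Delta(x)$, extended to finite sums; $\Gamma\setminus\!\!\setminus x$ maps $x$ to $[\,]$ and agrees with $\Gamma$ elsewhere. Judgements $\Gamma\vdash^{(m,e,s)} t:\sigma$ carry integer counters. System $\mathcal{V}$ has the rules: (var$_p$)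 $x:[\mathtt{vr}]\vdash^{(0,0,0)} x:\mathtt{vr}$; (val$_p$) $\emptyset\vdash^{(0,0,0)} x:\mathtt{vl}$; (abs$_p$) $\emptyset\vdash^{(0,0,0)}\lambda x.t:\mathtt{vl}$; (app$_p$) from $\Gamma\vdash^{(m,e,s)} t:\mathtt{tt}_1$ with $\mathtt{tt}_1\in\{\mathtt{vr},\mathtt{n}\}$ and $\Delta\vdash^{(m',e',s')} u:\mathtt{tt}_2$ with $\mathtt{tt}_2\in\{\mathtt{vl},\mathtt{n}\}$, infer $\Gamma+\Delta\vdash^{(m+m',e+e',s+s'+1)} t\,u:\mathtt{n}$; (es$_p$) from $\Gamma\vdash^{(m,e,s)} t:\tau$, $\Delta\vdash^{(m',e',s')} u:\mathtt{n}$ and $\Gamma(x)$ tight, infer $(\Gamma\setminus\!\!\setminus x)+\Delta\vdash^{(m+m',e+e',s+s')} t[x\backslash u]:\tau$; (var$_c$) $x:\mathcal{M}\vdash^{(0,1,0)} x:\mathcal{M}$ for any multitype $\mathcal{M}$; (app$_c$) from $\Gamma\vdash^{(m,e,s)} t:[\mathcal{M}\to\tau]$ and $\Delta\vdash^{(m',e',s')} u:\mathcal{M}$, infer $\Gamma+\Delta\vdash^{(m+m'+1,e+e'-1,s+s')} t\,u:\tau$; (appt$_c$) from $\Gamma\vdash^{(m,e,s)} t:[\mathcal{M}\to\tau]$, $\Delta\vdash^{(m',e',s')} u:\mathtt{n}$ and $\mathcal{M}$ tight, infer $\Gamma+\Delta\vdash^{(m+m'+1,e+e'-1,s+s')} t\,u:\tau$;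 (abs$_c$) from $\Gamma_i\vdash^{(m_i,e_i,s_i)} t:\tau_i$ for each $i\in I$ ($I$ finite, possibly empty), infer $+_{i\in I}(\Gamma_i\setminus\!\!\setminus x)\vdash^{(\sum_i m_i,\,1+\sum_i e_i,\,\sum_i s_i)}\lambda x.t:[\Gamma_i(x)\to\tau_i]_{i\in I}$; (es$_c$) from $\Gamma\vdash^{(m,e,s)} t:\sigma$ and $\Delta\vdash^{(m',e',s')} u:\Gamma(x)$, infer $(\Gamma\setminus\!\!\setminus x)+\Delta\vdash^{(m+m',e+e',s+s')} t[x\backslash u]:\sigma$. A multitype is tight if all its elements are tight types; a context is tight if all its multitypes are tight; a derivation of $\Gamma\vdash^{(m,e,s)} t:\sigma$ is tight if $\Gamma$ is tight and $\sigma$ is a tight type. -}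

module Defs where

open import Data.Nat using (ℕ; _≟_)
open import Data.Integer using (ℤ; _+_; 0ℤ; 1ℤ; -1ℤ)
open import Data.List using (List; []; _∷_; _++_; [_])
open import Data.List.Relation.Unary.All using (All)
open import Relation.Nullary using (does)
open import Data.Bool using (if_then_else_)

-- Terms (named, raw; variables are natural numbers).
-- All notions below are invariant under α-conversion, so quantifying
-- over raw terms is the same as quantifying over α-classes.

Var : Set
Var = ℕ

data Term : Set where
  var : Var → Term
  lam : Var → Term → Term
  app : Term → Term → Term
  es  : Term → Var → Term → Term      -- es t x u  =  t[x\u]

mutual
  data VrV : Term → Set where
    vr-var : ∀ {x} → VrV (var x)
    vr-es  : ∀ {t x u} → VrV t → NeV u → VrV (es t x u)

  data NeV : Term → Set where
    ne-vr  : ∀ {t u} → VrV t → NoV u → NeV (app t u)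
    ne-app : ∀ {t u} → NeV t → NoV u → NeV (app t u)
    ne-es  : ∀ {t x u} → NeV t → NeV u → NeV (es t x u)

  data NoV : Term → Set where
    no-lam : ∀ {x t} → NoV (lam x t)
    no-vr  : ∀ {t} → VrV t → NoV t
    no-ne  : ∀ {t} → NeV t → NoV t
    no-es  : ∀ {t x u} → NoV t → NeV u → NoV (es t x u)

-- Types; multitypes are lists taken up to (deep) permutation, see _≈_.

data Ty : Set where
  tn tvl tvr : Ty
  mult : List Ty → Ty
  arr  : List Ty → Ty → Ty

MTy : Set
MTy = List Ty

mutual
  data _≈_ : Ty → Ty → Set where
    ≈-n   : tn ≈ tn
    ≈-vl  : tvl ≈ tvl
    ≈-vr  : tvr ≈ tvr
    ≈-mult : ∀ {M N} → M ≈ₘ N → mult M ≈ mult N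
    ≈-arr  : ∀ {M N σ τ} → M ≈ₘ N → σ ≈ τ → arr M σ ≈ arr N τ

  data _≈ₘ_ : MTy → MTy → Set where
    ≈ₘ-[]    : [] ≈ₘ []
    ≈ₘ-cons  : ∀ {σ τ M N} → σ ≈ τ → M ≈ₘ N → (σ ∷ M) ≈ₘ (τ ∷ N)
    ≈ₘ-swap  : ∀ {σ τ M} → (σ ∷ τ ∷ M) ≈ₘ (τ ∷ σ ∷ M)
    ≈ₘ-trans : ∀ {M N P} → M ≈ₘ N → N ≈ₘ P → M ≈ₘ P

data IsTight : Ty → Set where
  tight-n  : IsTight tn
  tight-vl : IsTight tvl
  tight-vr : IsTight tvr

TightM : MTy → Set
TightM = All IsTight

Ctx : Set
Ctx = Var → MTy

∅ : Ctx
∅ _ = []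

_∶∶_ : Var → MTy → Ctx
(x ∶∶ M) y = if does (x ≟ y) then M else []

_⊕_ : Ctx → Ctx → Ctx
(Γ ⊕ Δ) y = Γ y ++ Δ y

_∖∖_ : Ctx → Var → Ctx
(Γ ∖∖ x) y = if does (x ≟ y) then [] else Γ y

_≈ᶜ_ : Ctx → Ctx → Set
Γ ≈ᶜ Δ = ∀ y → Γ y ≈ₘ Δ y

TightCtx : Ctx → Set
TightCtx Γ = ∀ y → TightM (Γ y)

data VrOrN : Ty → Set where
  is-vr : VrOrN tvr
  is-n  : VrOrN tn

data VlOrN : Ty → Set where
  is-vl : VlOrN tvl
  is-n  : VlOrN tn

infix 4 _⊢_∶_⟨_,_,_⟩

mutual
  data _⊢_∶_⟨_,_,_⟩ : Ctx → Term → Ty → ℤ → ℤ → ℤ → Set where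
    var-p : ∀ {x} → (x ∶∶ [ tvr ]) ⊢ var x ∶ tvr ⟨ 0ℤ , 0ℤ , 0ℤ ⟩
    val-p : ∀ {x} → ∅ ⊢ var x ∶ tvl ⟨ 0ℤ , 0ℤ , 0ℤ ⟩
    abs-p : ∀ {x t} → ∅ ⊢ lam x t ∶ tvl ⟨ 0ℤ , 0ℤ , 0ℤ ⟩
    app-p : ∀ {Γ Δ t u tt₁ tt₂ m e s m' e' s'} →
            Γ ⊢ t ∶ tt₁ ⟨ m , e , s ⟩ → VrOrN tt₁ →
            Δ ⊢ u ∶ tt₂ ⟨ m' , e' , s' ⟩ → VlOrN tt₂ →
            (Γ ⊕ Δ) ⊢ app t u ∶ tn ⟨ m + m' , e + e' , (s + s') + 1ℤ ⟩
    es-p  : ∀ {Γ Δ t u x τ m e s m' e' s'} →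
            Γ ⊢ t ∶ τ ⟨ m , e , s ⟩ →
            Δ ⊢ u ∶ tn ⟨ m' , e' , s' ⟩ →
            TightM (Γ x) →
            ((Γ ∖∖ x) ⊕ Δ) ⊢ es t x u ∶ τ ⟨ m + m' , e + e' , s + s' ⟩
    var-c : ∀ {x M} → (x ∶∶ M) ⊢ var x ∶ mult M ⟨ 0ℤ , 1ℤ , 0ℤ ⟩
    app-c : ∀ {Γ Δ t u M τ m e s m' e' s'} →
            Γ ⊢ t ∶ mult [ arr M τ ] ⟨ m , e , s ⟩ →
            Δ ⊢ u ∶ mult M ⟨ m' , e' , s' ⟩ →
            (Γ ⊕ Δ) ⊢ app t u ∶ τ ⟨ (m + m') + 1ℤ , (e + e') + -1ℤ , s + s' ⟩
    appt-c : ∀ {Γ Δ t u M τ m e s m' e' s'} →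
            Γ ⊢ t ∶ mult [ arr M τ ] ⟨ m , e , s ⟩ →
            Δ ⊢ u ∶ tn ⟨ m' , e' , s' ⟩ →
            TightM M →
            (Γ ⊕ Δ) ⊢ app t u ∶ τ ⟨ (m + m') + 1ℤ , (e + e') + -1ℤ , s + s' ⟩
    abs-c : ∀ {Γ x t M m e s} →
            AbsFam x t Γ M m e s →
            Γ ⊢ lam x t ∶ mult M ⟨ m , 1ℤ + e , s ⟩
    es-c  : ∀ {Γ Δ t u x σ m e s m' e' s'} →
            Γ ⊢ t ∶ σ ⟨ m , e , s ⟩ →
            Δ ⊢ u ∶ mult (Γ x) ⟨ m' , e' , s' ⟩ →
            ((Γ ∖∖ x) ⊕ Δ) ⊢ es t x u ∶ σ ⟨ m + m' , e + e' , s + s' ⟩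
    -- multitypes are multisets: judgements are closed under
    -- (deep) multiset equality of contexts and types
    conv  : ∀ {Γ Γ' t σ σ' m e s} →
            Γ ⊢ t ∶ σ ⟨ m , e , s ⟩ → Γ ≈ᶜ Γ' → σ ≈ σ' →
            Γ' ⊢ t ∶ σ' ⟨ m , e , s ⟩

  -- the finite family of premises of abs_c, i ∈ I
  data AbsFam (x : Var) (t : Term) : Ctx → MTy → ℤ → ℤ → ℤ → Set where
    fam-[] : AbsFam x t ∅ [] 0ℤ 0ℤ 0ℤ
    fam-∷  : ∀ {Γ Δ τ M m e s m' e' s'} →
             Γ ⊢ t ∶ τ ⟨ m , e , s ⟩ →
             AbsFam x t Δ M m' e' s' →
             AbsFam x t ((Γ ∖∖ x) ⊕ Δ) (arr (Γ x) τ ∷ M) (m + m') (e + e') (s + s')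

{-# OPTIONS --safe #-}
module Submission where

-- The counter m is a sum of natural numbers, and so is e once m = 0; hence zero
-- counters pass to every premise. Then var_c and abs_c (an exponential step) and
-- app_c, appt_c (a multiplicative step) cannot occur, so no multitype is derived,
-- which excludes es_c as well; the persistent rules that remain build exactly the
-- normal forms of the class selected by the type (n: ne_v, vr: vr_v, vl: no_v).
-- Conversely, in a tight context a vr_v term only receives vr, vl or a tight
-- multitype and a ne_v term only n; this excludes app_c, appt_c and es_c on normal
-- forms, and the remaining rules keep both counters 0.

open import Defs
open import Data.Bool using (if_then_else_)
open import Data.Empty using (⊥; ⊥-elim)
open import Data.Integer using (ℤ; 0ℤ; 1ℤ; +_; _+_)
open import Data.Integer.Properties using (+-injective)
open import Data.List using ([]; [_])
open import Data.List.Relation.Unary.All using ([]; _∷_)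
open import Data.List.Relation.Unary.All.Properties using (++⁻ˡ; ++⁻ʳ)
open import Data.Nat using (_≟_) renaming (_+_ to _+ℕ_)
open import Data.Nat.Properties using (m+n≡0⇒m≡0; m+n≡0⇒n≡0; m+1+n≢0)
open import Data.Product using (_×_; _,_; ∃-syntax)
open import Function.Bundles using (_⇔_; mk⇔)
open import Relation.Nullary using (¬_; yes; no)
open import Relation.Nullary.Decidable using (dec-true; dec-false)
open import Relation.Binary.PropositionalEquality using (_≡_; _≢_; refl; cong; subst)

Natural : ℤ → Set
Natural i = ∃[ n ] i ≡ + n

natural-+ : ∀ {i j} → Natural i → Natural j → Natural (i + j)
natural-+ (a , refl) (b , refl) = a +ℕ b , refl

natural-+≡0 : ∀ {i j} → Natural i → Natural j → i + j ≡ 0ℤ → i ≡ 0ℤ × j ≡ 0ℤ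
natural-+≡0 (a , refl) (b , refl) eq =
  cong +_ (m+n≡0⇒m≡0 a (+-injective eq)) , cong +_ (m+n≡0⇒n≡0 a (+-injective eq))

natural-+1≢0 : ∀ {i} → Natural i → i + 1ℤ ≢ 0ℤ
natural-+1≢0 (a , refl) eq = m+1+n≢0 a (+-injective eq)

1+natural≢0 : ∀ {i} → Natural i → 1ℤ + i ≢ 0ℤ
1+natural≢0 (a , refl) ()

ZeroCounters : ℤ → ℤ → Set
ZeroCounters m e = m ≡ 0ℤ × e ≡ 0ℤ

zero-counters-+ : ∀ {m e m' e'} → ZeroCounters m e → ZeroCounters m' e' →
                  ZeroCounters (m + m') (e + e')
zero-counters-+ (refl , refl) (refl , refl) = refl , refl

mutual
  m-natural : ∀ {Γ t σ m e s} → Γ ⊢ t ∶ σ ⟨ m , e , s ⟩ → Natural m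
  m-natural var-p            = 0 , refl
  m-natural val-p            = 0 , refl
  m-natural abs-p            = 0 , refl
  m-natural (app-p d _ d' _) = natural-+ (m-natural d) (m-natural d')
  m-natural (es-p d d' _)    = natural-+ (m-natural d) (m-natural d')
  m-natural var-c            = 0 , refl
  m-natural (app-c d d')     = natural-+ (natural-+ (m-natural d) (m-natural d')) (1 , refl)
  m-natural (appt-c d d' _)  = natural-+ (natural-+ (m-natural d) (m-natural d')) (1 , refl)
  m-natural (abs-c f)        = m-natural-fam f
  m-natural (es-c d d')      = natural-+ (m-natural d) (m-natural d')
  m-natural (conv d _ _)     = m-natural d

  m-natural-fam : ∀ {x t Γ M m e s} → AbsFam x t Γ M m e s → Natural m
  m-natural-fam fam-[]      = 0 , refl
  m-natural-fam (fam-∷ d f) = natural-+ (m-natural d) (m-natural-fam f)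

multiplicative-step≢0 : ∀ {Γ Δ t u σ τ m e s m' e' s'} →
  Γ ⊢ t ∶ σ ⟨ m , e , s ⟩ → Δ ⊢ u ∶ τ ⟨ m' , e' , s' ⟩ → (m + m') + 1ℤ ≢ 0ℤ
multiplicative-step≢0 d d' = natural-+1≢0 (natural-+ (m-natural d) (m-natural d'))

mutual
  e-natural : ∀ {Γ t σ m e s} → Γ ⊢ t ∶ σ ⟨ m , e , s ⟩ → m ≡ 0ℤ → Natural e
  e-natural var-p _              = 0 , refl
  e-natural val-p _              = 0 , refl
  e-natural abs-p _              = 0 , refl
  e-natural (app-p d _ d' _) m≡0 = e-natural-+ d d' m≡0
  e-natural (es-p d d' _) m≡0    = e-natural-+ d d' m≡0
  e-natural var-c _              = 1 , refl
  e-natural (app-c d d') m≡0     = ⊥-elim (multiplicative-step≢0 d d' m≡0)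
  e-natural (appt-c d d' _) m≡0  = ⊥-elim (multiplicative-step≢0 d d' m≡0)
  e-natural (abs-c f) m≡0        = natural-+ (1 , refl) (e-natural-fam f m≡0)
  e-natural (es-c d d') m≡0      = e-natural-+ d d' m≡0
  e-natural (conv d _ _) m≡0     = e-natural d m≡0

  e-natural-+ : ∀ {Γ Δ t u σ τ m e s m' e' s'} →
    Γ ⊢ t ∶ σ ⟨ m , e , s ⟩ → Δ ⊢ u ∶ τ ⟨ m' , e' , s' ⟩ → m + m' ≡ 0ℤ → Natural (e + e')
  e-natural-+ d d' hm with natural-+≡0 (m-natural d) (m-natural d') hm
  ... | m≡0 , m'≡0 = natural-+ (e-natural d m≡0) (e-natural d' m'≡0)

  e-natural-fam : ∀ {x t Γ M m e s} → AbsFam x t Γ M m e s → m ≡ 0ℤ → Natural e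
  e-natural-fam fam-[] _ = 0 , refl
  e-natural-fam (fam-∷ d f) hm with natural-+≡0 (m-natural d) (m-natural-fam f) hm
  ... | m≡0 , m'≡0 = natural-+ (e-natural d m≡0) (e-natural-fam f m'≡0)

zero-counters-split : ∀ {Γ Δ t u σ τ m e s m' e' s'} →
  Γ ⊢ t ∶ σ ⟨ m , e , s ⟩ → Δ ⊢ u ∶ τ ⟨ m' , e' , s' ⟩ →
  ZeroCounters (m + m') (e + e') → ZeroCounters m e × ZeroCounters m' e'
zero-counters-split d d' (hm , he) with natural-+≡0 (m-natural d) (m-natural d') hm
... | m≡0 , m'≡0 with natural-+≡0 (e-natural d m≡0) (e-natural d' m'≡0) he
... | e≡0 , e'≡0 = (m≡0 , e≡0) , (m'≡0 , e'≡0)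

Shape : Ty → Term → Set
Shape tn        t = NeV t
Shape tvr       t = VrV t
Shape tvl       t = NoV t
Shape (mult _)  _ = ⊥
Shape (arr _ _) _ = ⊥

Shape-≈ : ∀ {σ τ t} → σ ≈ τ → Shape σ t → Shape τ t
Shape-≈ ≈-n  r = r
Shape-≈ ≈-vl r = r
Shape-≈ ≈-vr r = r

Shape-app : ∀ {t u tt₁ tt₂} → VrOrN tt₁ → Shape tt₁ t → VlOrN tt₂ → Shape tt₂ u →
            NeV (app t u)
Shape-app is-vr v is-vl o  = ne-vr v o
Shape-app is-vr v is-n  n  = ne-vr v (no-ne n)
Shape-app is-n  n is-vl o  = ne-app n o
Shape-app is-n  n is-n  n' = ne-app n (no-ne n')

Shape-es : ∀ {τ t x u} → Shape τ t → NeV u → Shape τ (es t x u)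
Shape-es {tn}  n n' = ne-es n n'
Shape-es {tvl} o n  = no-es o n
Shape-es {tvr} v n  = vr-es v n

Shape-tight⇒NoV : ∀ {σ t} → IsTight σ → Shape σ t → NoV t
Shape-tight⇒NoV tight-n  n = no-ne n
Shape-tight⇒NoV tight-vl o = o
Shape-tight⇒NoV tight-vr v = no-vr v

zero-counters⇒Shape : ∀ {Γ t σ m e s} → Γ ⊢ t ∶ σ ⟨ m , e , s ⟩ → ZeroCounters m e → Shape σ t
zero-counters⇒Shape var-p _ = vr-var
zero-counters⇒Shape val-p _ = no-vr vr-var
zero-counters⇒Shape abs-p _ = no-lam
zero-counters⇒Shape (app-p d p d' q) z with zero-counters-split d d' z
... | z₁ , z₂ = Shape-app p (zero-counters⇒Shape d z₁) q (zero-counters⇒Shape d' z₂)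
zero-counters⇒Shape (es-p d d' _) z with zero-counters-split d d' z
... | z₁ , z₂ = Shape-es (zero-counters⇒Shape d z₁) (zero-counters⇒Shape d' z₂)
zero-counters⇒Shape var-c (_ , ())
zero-counters⇒Shape (app-c d d') (m≡0 , _) = ⊥-elim (multiplicative-step≢0 d d' m≡0)
zero-counters⇒Shape (appt-c d d' _) (m≡0 , _) = ⊥-elim (multiplicative-step≢0 d d' m≡0)
zero-counters⇒Shape (abs-c f) (m≡0 , e≡0) = ⊥-elim (1+natural≢0 (e-natural-fam f m≡0) e≡0)
zero-counters⇒Shape (es-c d d') z with zero-counters-split d d' z
... | _ , z₂ = ⊥-elim (zero-counters⇒Shape d' z₂)
zero-counters⇒Shape (conv d _ eq) z = Shape-≈ eq (zero-counters⇒Shape d z)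

mutual
  ≈-sym : ∀ {σ τ} → σ ≈ τ → τ ≈ σ
  ≈-sym ≈-n         = ≈-n
  ≈-sym ≈-vl        = ≈-vl
  ≈-sym ≈-vr        = ≈-vr
  ≈-sym (≈-mult p)  = ≈-mult (≈ₘ-sym p)
  ≈-sym (≈-arr p q) = ≈-arr (≈ₘ-sym p) (≈-sym q)

  ≈ₘ-sym : ∀ {M N} → M ≈ₘ N → N ≈ₘ M
  ≈ₘ-sym ≈ₘ-[]          = ≈ₘ-[]
  ≈ₘ-sym (≈ₘ-cons p q)  = ≈ₘ-cons (≈-sym p) (≈ₘ-sym q)
  ≈ₘ-sym ≈ₘ-swap        = ≈ₘ-swap
  ≈ₘ-sym (≈ₘ-trans p q) = ≈ₘ-trans (≈ₘ-sym q) (≈ₘ-sym p)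

≈-tight : ∀ {σ τ} → σ ≈ τ → IsTight σ → IsTight τ
≈-tight ≈-n  t = t
≈-tight ≈-vl t = t
≈-tight ≈-vr t = t

≈ₘ-tight : ∀ {M N} → M ≈ₘ N → TightM M → TightM N
≈ₘ-tight ≈ₘ-[]          t              = t
≈ₘ-tight (≈ₘ-cons p q)  (tσ ∷ tM)      = ≈-tight p tσ ∷ ≈ₘ-tight q tM
≈ₘ-tight ≈ₘ-swap        (tσ ∷ tτ ∷ tM) = tτ ∷ tσ ∷ tM
≈ₘ-tight (≈ₘ-trans p q) t              = ≈ₘ-tight q (≈ₘ-tight p t)

≈ᶜ-tight⁻ : ∀ {Γ Γ'} → Γ ≈ᶜ Γ' → TightCtx Γ' → TightCtx Γ
≈ᶜ-tight⁻ p tc y = ≈ₘ-tight (≈ₘ-sym (p y)) (tc y)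

⊕-tightˡ : ∀ {Γ Δ} → TightCtx (Γ ⊕ Δ) → TightCtx Γ
⊕-tightˡ {Γ} tc y = ++⁻ˡ (Γ y) (tc y)

⊕-tightʳ : ∀ {Γ Δ} → TightCtx (Γ ⊕ Δ) → TightCtx Δ
⊕-tightʳ {Γ} tc y = ++⁻ʳ (Γ y) (tc y)

∖∖-≢ : ∀ (Γ : Ctx) {x y} → x ≢ y → (Γ ∖∖ x) y ≡ Γ y
∖∖-≢ Γ {x} {y} x≢y = cong (if_then [] else Γ y) (dec-false (x ≟ y) x≢y)

∖∖-tight : ∀ {Γ x} → TightM (Γ x) → TightCtx (Γ ∖∖ x) → TightCtx Γ
∖∖-tight {Γ} {x} tx tc y with x ≟ y
... | yes refl = tx
... | no x≢y   = subst TightM (∖∖-≢ Γ x≢y) (tc y)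

∶∶-self : ∀ x M → (x ∶∶ M) x ≡ M
∶∶-self x M = cong (if_then M else []) (dec-true (x ≟ x) refl)

∶∶-tight : ∀ x {M} → TightCtx (x ∶∶ M) → TightM M
∶∶-tight x {M} tc = subst TightM (∶∶-self x M) (tc x)

es-body-tight : ∀ {Γ Δ} x → TightCtx ((Γ ∖∖ x) ⊕ Δ) → TightM (Γ x) → TightCtx Γ
es-body-tight {Γ} x tc tx = ∖∖-tight tx (⊕-tightˡ {Γ ∖∖ x} tc)

es-arg-tight : ∀ {Γ Δ} x → TightCtx ((Γ ∖∖ x) ⊕ Δ) → TightCtx Δ
es-arg-tight {Γ} x = ⊕-tightʳ {Γ ∖∖ x}

data VarLikeType : Ty → Set where
  var-vr   : VarLikeType tvr
  var-vl   : VarLikeType tvl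
  var-mult : ∀ {M} → TightM M → VarLikeType (mult M)

VarLikeType-≈ : ∀ {σ τ} → σ ≈ τ → VarLikeType σ → VarLikeType τ
VarLikeType-≈ ≈-vr       var-vr       = var-vr
VarLikeType-≈ ≈-vl       var-vl       = var-vl
VarLikeType-≈ (≈-mult p) (var-mult t) = var-mult (≈ₘ-tight p t)

mutual
  vr-type : ∀ {Γ t σ m e s} → VrV t → TightCtx Γ → Γ ⊢ t ∶ σ ⟨ m , e , s ⟩ → VarLikeType σ
  vr-type vr-var       _  var-p                 = var-vr
  vr-type vr-var       _  val-p                 = var-vl
  vr-type (vr-var {x}) tc var-c                 = var-mult (∶∶-tight x tc)
  vr-type (vr-es v _)  tc (es-p {x = x} d _ tx) = vr-type v (es-body-tight x tc tx) d
  vr-type (vr-es _ n)  tc (es-c {x = x} _ d')   = ⊥-elim (ne-not-mult n (es-arg-tight x tc) d')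
  vr-type v            tc (conv d c eq)         = VarLikeType-≈ eq (vr-type v (≈ᶜ-tight⁻ c tc) d)

  vr-not-function : ∀ {Γ t M τ m e s} → VrV t → TightCtx Γ →
                    ¬ Γ ⊢ t ∶ mult [ arr M τ ] ⟨ m , e , s ⟩
  vr-not-function v tc d with vr-type v tc d
  ... | var-mult (() ∷ [])

  ne-type : ∀ {Γ t σ m e s} → NeV t → TightCtx Γ → Γ ⊢ t ∶ σ ⟨ m , e , s ⟩ → σ ≡ tn
  ne-type (ne-vr _ _)  _  (app-p _ _ _ _) = refl
  ne-type (ne-app _ _) _  (app-p _ _ _ _) = refl
  ne-type (ne-vr v _)  tc (app-c d _)     = ⊥-elim (vr-not-function v (⊕-tightˡ tc) d)
  ne-type (ne-vr v _)  tc (appt-c d _ _)  = ⊥-elim (vr-not-function v (⊕-tightˡ tc) d)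
  ne-type (ne-app n _) tc (app-c d _)     = ⊥-elim (ne-not-mult n (⊕-tightˡ tc) d)
  ne-type (ne-app n _) tc (appt-c d _ _)  = ⊥-elim (ne-not-mult n (⊕-tightˡ tc) d)
  ne-type (ne-es n _)  tc (es-p {x = x} d _ tx) =
    ne-type n (es-body-tight x tc tx) d
  ne-type (ne-es _ n)  tc (es-c {x = x} _ d') =
    ⊥-elim (ne-not-mult n (es-arg-tight x tc) d')
  ne-type n tc (conv d c eq) with ne-type n (≈ᶜ-tight⁻ c tc) d | eq
  ... | refl | ≈-n = refl

  ne-not-mult : ∀ {Γ t M m e s} → NeV t → TightCtx Γ → ¬ Γ ⊢ t ∶ mult M ⟨ m , e , s ⟩
  ne-not-mult n tc d with ne-type n tc d
  ... | ()

VrOrN-tight : ∀ {σ} → VrOrN σ → IsTight σ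
VrOrN-tight is-vr = tight-vr
VrOrN-tight is-n  = tight-n

VlOrN-tight : ∀ {σ} → VlOrN σ → IsTight σ
VlOrN-tight is-vl = tight-vl
VlOrN-tight is-n  = tight-n

mutual
  vr-zero-counters : ∀ {Γ t σ m e s} → VrV t → TightCtx Γ → IsTight σ →
                     Γ ⊢ t ∶ σ ⟨ m , e , s ⟩ → ZeroCounters m e
  vr-zero-counters vr-var _ _  var-p = refl , refl
  vr-zero-counters vr-var _ _  val-p = refl , refl
  vr-zero-counters vr-var _ () var-c
  vr-zero-counters (vr-es v n) tc tσ (es-p {x = x} d d' tx) =
    zero-counters-+ (vr-zero-counters v (es-body-tight x tc tx) tσ d)
                    (ne-zero-counters n (es-arg-tight x tc) d')
  vr-zero-counters (vr-es _ n) tc _ (es-c {x = x} _ d') =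
    ⊥-elim (ne-not-mult n (es-arg-tight x tc) d')
  vr-zero-counters v tc tσ (conv d c eq) =
    vr-zero-counters v (≈ᶜ-tight⁻ c tc) (≈-tight (≈-sym eq) tσ) d

  ne-zero-counters : ∀ {Γ t σ m e s} → NeV t → TightCtx Γ →
                     Γ ⊢ t ∶ σ ⟨ m , e , s ⟩ → ZeroCounters m e
  ne-zero-counters (ne-vr v o) tc (app-p d p d' q) =
    zero-counters-+ (vr-zero-counters v (⊕-tightˡ tc) (VrOrN-tight p) d)
                    (no-zero-counters o (⊕-tightʳ tc) (VlOrN-tight q) d')
  ne-zero-counters (ne-app n o) tc (app-p d _ d' q) =
    zero-counters-+ (ne-zero-counters n (⊕-tightˡ tc) d)
                    (no-zero-counters o (⊕-tightʳ tc) (VlOrN-tight q) d')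
  ne-zero-counters (ne-vr v _)  tc (app-c d _)    = ⊥-elim (vr-not-function v (⊕-tightˡ tc) d)
  ne-zero-counters (ne-vr v _)  tc (appt-c d _ _) = ⊥-elim (vr-not-function v (⊕-tightˡ tc) d)
  ne-zero-counters (ne-app n _) tc (app-c d _)    = ⊥-elim (ne-not-mult n (⊕-tightˡ tc) d)
  ne-zero-counters (ne-app n _) tc (appt-c d _ _) = ⊥-elim (ne-not-mult n (⊕-tightˡ tc) d)
  ne-zero-counters (ne-es n n') tc (es-p {x = x} d d' tx) =
    zero-counters-+ (ne-zero-counters n (es-body-tight x tc tx) d)
                    (ne-zero-counters n' (es-arg-tight x tc) d')
  ne-zero-counters (ne-es _ n') tc (es-c {x = x} _ d') =
    ⊥-elim (ne-not-mult n' (es-arg-tight x tc) d')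
  ne-zero-counters n tc (conv d c _) = ne-zero-counters n (≈ᶜ-tight⁻ c tc) d

  no-zero-counters : ∀ {Γ t σ m e s} → NoV t → TightCtx Γ → IsTight σ →
                     Γ ⊢ t ∶ σ ⟨ m , e , s ⟩ → ZeroCounters m e
  no-zero-counters (no-vr v) tc tσ d = vr-zero-counters v tc tσ d
  no-zero-counters (no-ne n) tc _  d = ne-zero-counters n tc d
  no-zero-counters no-lam    _  _  abs-p = refl , refl
  no-zero-counters no-lam    _  () (abs-c _)
  no-zero-counters (no-es o n) tc tσ (es-p {x = x} d d' tx) =
    zero-counters-+ (no-zero-counters o (es-body-tight x tc tx) tσ d)
                    (ne-zero-counters n (es-arg-tight x tc) d')
  no-zero-counters (no-es _ n) tc _ (es-c {x = x} _ d') =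
    ⊥-elim (ne-not-mult n (es-arg-tight x tc) d')
  no-zero-counters o tc tσ (conv d c eq) =
    no-zero-counters o (≈ᶜ-tight⁻ c tc) (≈-tight (≈-sym eq) tσ) d

lemma4p3 : ∀ {Γ t σ m e s} →
    Γ ⊢ t ∶ σ ⟨ m , e , s ⟩ → TightCtx Γ → IsTight σ →
    ((m ≡ 0ℤ × e ≡ 0ℤ) ⇔ NoV t)
lemma4p3 d tc tσ = mk⇔ (λ z → Shape-tight⇒NoV tσ (zero-counters⇒Shape d z))
                       (λ o → no-zero-counters o tc tσ d)
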